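{- In $\mathbf{IPF}^\iota$, for every formula $F$, variables $x\neq y$, and formula $G(z)$ with a free variable $z$: $\exists!\iota xF,\ G(\iota xF)\vdash\exists y(\forall x(F\leftrightarrow x=y)\land G(y))$.
   Context: $G(t)$ denotes the result of substituting the term $t$ for $z$ in $G(z)$ (with $y$ assumed not to occur in $F$ or $G$ otherwise). $\mathbf{IPF}$ is a natural deduction system of intuitionist positive free logic: a first-order language without function symbols, primitive predicate $\exists!$ ("exists"), identity; standard intuitionist rules for $\land,\rightarrow,\lor,\leftrightarrow$, $\bot E$ to atomic conclusions; $\forall I$ (infer $\forall xA$ from a deduction of $A^x_a$, discharging $\exists!a$, $a$ fresh), $\forall E$ (from $\forall xA$ and $\exists!t$ infer $A^x_t$), $\exists I$ (from $A^x_t$ and $\exists!t$ infer $\exists xA$), $\exists E$ (from $\exists xA$ and a deduction of $C$ from $A^x_a,\exists!a$ infer $C$, discharging them, $a$ fresh); $=I$: axiom $t=t$; $=E$: from $t_1=t_2$ and $A^x_{t_1}$ infer $A^x_{t_2}$ ($A$ atomic). $\mathbf{IPF}^\iota$ extends $\mathbf{IPF}$ by description terms $\iota xF$ ("the $F$", binding $x$), terms $t$ ranging also over these, and the axiom (Lambert's Law) $\forall y(\iota xF=y\leftrightarrow\forall x(F\leftrightarrow x=y))$ for distinct $x,y$. -}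

module Defs where

-- Syntax and natural-deduction system of IPF^ι (intuitionist positive free
-- logic with definite descriptions and Lambert's Law), Prawitz/Tennant style:
-- bound variables (Var) and parameters (Par, the "a" of ∀I/∃E) are distinct sorts.

open import Data.Nat using (ℕ; _≡ᵇ_)
open import Data.Bool using (Bool; true; false; not; if_then_else_; _∧_; _∨_)
open import Data.List using (List; []; _∷_)
open import Data.List.Relation.Unary.All using (All)
open import Data.List.Membership.Propositional using (_∈_)
open import Relation.Binary.PropositionalEquality using (_≡_; _≢_)

Var : Set
Var = ℕ

Par : Set
Par = ℕ

PredSym : Set
PredSym = ℕ

infix  6 _≐_
infixr 5 _∧'_
infixr 4 _∨'_
infixr 3 _⇒_ _⇔_

mutual
  data Term : Set where
    var : Var → Term
    par : Par → Term
    ι   : Var → Formula → Term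

  data Formula : Set where
    rel  : PredSym → List Term → Formula
    E!   : Term → Formula                  -- ∃! t  ("t exists")
    _≐_  : Term → Term → Formula
    ⊥'   : Formula
    _∧'_ : Formula → Formula → Formula
    _⇒_  : Formula → Formula → Formula
    _∨'_ : Formula → Formula → Formula
    _⇔_  : Formula → Formula → Formula
    ∀'   : Var → Formula → Formula
    ∃'   : Var → Formula → Formula

-- It does not rename; rules that use it demand
-- that t be substitutable (free) for x (see Substitutable below).

mutual
  substT : Term → Var → Term → Term
  substT (var w)   x t = if w ≡ᵇ x then t else var w
  substT (par a)   x t = par a
  substT (ι w F)   x t = if w ≡ᵇ x then ι w F else ι w (substF F x t)

  substTs : List Term → Var → Term → List Term
  substTs []       x t = []
  substTs (s ∷ ss) x t = substT s x t ∷ substTs ss x t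

  substF : Formula → Var → Term → Formula
  substF (rel P ts) x t = rel P (substTs ts x t)
  substF (E! s)     x t = E! (substT s x t)
  substF (s ≐ r)    x t = substT s x t ≐ substT r x t
  substF ⊥'         x t = ⊥'
  substF (A ∧' B)   x t = substF A x t ∧' substF B x t
  substF (A ⇒ B)    x t = substF A x t ⇒ substF B x t
  substF (A ∨' B)   x t = substF A x t ∨' substF B x t
  substF (A ⇔ B)    x t = substF A x t ⇔ substF B x t
  substF (∀' w A)   x t = if w ≡ᵇ x then ∀' w A else ∀' w (substF A x t)
  substF (∃' w A)   x t = if w ≡ᵇ x then ∃' w A else ∃' w (substF A x t)

_[_≔_] : Formula → Var → Term → Formula
A [ x ≔ t ] = substF A x t

mutual
  freeT : Var → Term → Bool
  freeT x (var w) = w ≡ᵇ x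
  freeT x (par a) = false
  freeT x (ι w F) = if w ≡ᵇ x then false else freeF x F

  freeTs : Var → List Term → Bool
  freeTs x []       = false
  freeTs x (s ∷ ss) = freeT x s ∨ freeTs x ss

  freeF : Var → Formula → Bool
  freeF x (rel P ts) = freeTs x ts
  freeF x (E! s)     = freeT x s
  freeF x (s ≐ r)    = freeT x s ∨ freeT x r
  freeF x ⊥'         = false
  freeF x (A ∧' B)   = freeF x A ∨ freeF x B
  freeF x (A ⇒ B)    = freeF x A ∨ freeF x B
  freeF x (A ∨' B)   = freeF x A ∨ freeF x B
  freeF x (A ⇔ B)    = freeF x A ∨ freeF x B
  freeF x (∀' w A)   = if w ≡ᵇ x then false else freeF x A
  freeF x (∃' w A)   = if w ≡ᵇ x then false else freeF x A

mutual
  occT : Var → Term → Bool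
  occT x (var w) = w ≡ᵇ x
  occT x (par a) = false
  occT x (ι w F) = (w ≡ᵇ x) ∨ occF x F

  occTs : Var → List Term → Bool
  occTs x []       = false
  occTs x (s ∷ ss) = occT x s ∨ occTs x ss

  occF : Var → Formula → Bool
  occF x (rel P ts) = occTs x ts
  occF x (E! s)     = occT x s
  occF x (s ≐ r)    = occT x s ∨ occT x r
  occF x ⊥'         = false
  occF x (A ∧' B)   = occF x A ∨ occF x B
  occF x (A ⇒ B)    = occF x A ∨ occF x B
  occF x (A ∨' B)   = occF x A ∨ occF x B
  occF x (A ⇔ B)    = occF x A ∨ occF x B
  occF x (∀' w A)   = (w ≡ᵇ x) ∨ occF x A
  occF x (∃' w A)   = (w ≡ᵇ x) ∨ occF x A

mutual
  parT : Par → Term → Bool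
  parT a (var w) = false
  parT a (par b) = b ≡ᵇ a
  parT a (ι w F) = parF a F

  parTs : Par → List Term → Bool
  parTs a []       = false
  parTs a (s ∷ ss) = parT a s ∨ parTs a ss

  parF : Par → Formula → Bool
  parF a (rel P ts) = parTs a ts
  parF a (E! s)     = parT a s
  parF a (s ≐ r)    = parT a s ∨ parT a r
  parF a ⊥'         = false
  parF a (A ∧' B)   = parF a A ∨ parF a B
  parF a (A ⇒ B)    = parF a A ∨ parF a B
  parF a (A ∨' B)   = parF a A ∨ parF a B
  parF a (A ⇔ B)    = parF a A ∨ parF a B
  parF a (∀' w A)   = parF a A
  parF a (∃' w A)   = parF a A

FreshIn : Par → Formula → Set
FreshIn a A = parF a A ≡ false

FreshInAll : Par → List Formula → Set
FreshInAll a Γ = All (FreshIn a) Γ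

mutual
  subOKT : Term → Var → Term → Bool
  subOKT t x (var w) = true
  subOKT t x (par a) = true
  subOKT t x (ι w F) =
    if not (freeT x (ι w F)) then true else (not (freeT w t) ∧ subOKF t x F)

  subOKTs : Term → Var → List Term → Bool
  subOKTs t x []       = true
  subOKTs t x (s ∷ ss) = subOKT t x s ∧ subOKTs t x ss

  subOKF : Term → Var → Formula → Bool
  subOKF t x (rel P ts) = subOKTs t x ts
  subOKF t x (E! s)     = subOKT t x s
  subOKF t x (s ≐ r)    = subOKT t x s ∧ subOKT t x r
  subOKF t x ⊥'         = true
  subOKF t x (A ∧' B)   = subOKF t x A ∧ subOKF t x B
  subOKF t x (A ⇒ B)    = subOKF t x A ∧ subOKF t x B
  subOKF t x (A ∨' B)   = subOKF t x A ∧ subOKF t x B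
  subOKF t x (A ⇔ B)    = subOKF t x A ∧ subOKF t x B
  subOKF t x (∀' w A)   =
    if not (freeF x (∀' w A)) then true else (not (freeT w t) ∧ subOKF t x A)
  subOKF t x (∃' w A)   =
    if not (freeF x (∃' w A)) then true else (not (freeT w t) ∧ subOKF t x A)

Substitutable : Term → Var → Formula → Set
Substitutable t x A = subOKF t x A ≡ true

data Atomic : Formula → Set where
  at-rel : ∀ {P ts} → Atomic (rel P ts)
  at-E!  : ∀ {t} → Atomic (E! t)
  at-≐   : ∀ {s t} → Atomic (s ≐ t)
  at-⊥   : Atomic ⊥'

infix 2 _⊢_

data _⊢_ (Γ : List Formula) : Formula → Set where
  hyp  : ∀ {A} → A ∈ Γ → Γ ⊢ A
  ∧I   : ∀ {A B} → Γ ⊢ A → Γ ⊢ B → Γ ⊢ A ∧' B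
  ∧E₁  : ∀ {A B} → Γ ⊢ A ∧' B → Γ ⊢ A
  ∧E₂  : ∀ {A B} → Γ ⊢ A ∧' B → Γ ⊢ B
  ⇒I   : ∀ {A B} → (A ∷ Γ) ⊢ B → Γ ⊢ A ⇒ B
  ⇒E   : ∀ {A B} → Γ ⊢ A ⇒ B → Γ ⊢ A → Γ ⊢ B
  ∨I₁  : ∀ {A B} → Γ ⊢ A → Γ ⊢ A ∨' B
  ∨I₂  : ∀ {A B} → Γ ⊢ B → Γ ⊢ A ∨' B
  ∨E   : ∀ {A B C} → Γ ⊢ A ∨' B → (A ∷ Γ) ⊢ C → (B ∷ Γ) ⊢ C → Γ ⊢ C
  ⇔I   : ∀ {A B} → (A ∷ Γ) ⊢ B → (B ∷ Γ) ⊢ A → Γ ⊢ A ⇔ B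
  ⇔E₁  : ∀ {A B} → Γ ⊢ A ⇔ B → Γ ⊢ A → Γ ⊢ B
  ⇔E₂  : ∀ {A B} → Γ ⊢ A ⇔ B → Γ ⊢ B → Γ ⊢ A
  ⊥E   : ∀ {C} → Atomic C → Γ ⊢ ⊥' → Γ ⊢ C
  ∀I   : ∀ {A x} (a : Par) → FreshInAll a Γ → FreshIn a (∀' x A) →
         (E! (par a) ∷ Γ) ⊢ A [ x ≔ par a ] → Γ ⊢ ∀' x A
  ∀E   : ∀ {A x} (t : Term) → Substitutable t x A →
         Γ ⊢ ∀' x A → Γ ⊢ E! t → Γ ⊢ A [ x ≔ t ]
  ∃I   : ∀ {A x} (t : Term) → Substitutable t x A →
         Γ ⊢ A [ x ≔ t ] → Γ ⊢ E! t → Γ ⊢ ∃' x A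
  ∃E   : ∀ {A x C} (a : Par) → FreshInAll a Γ → FreshIn a (∃' x A) → FreshIn a C →
         Γ ⊢ ∃' x A → (A [ x ≔ par a ] ∷ E! (par a) ∷ Γ) ⊢ C → Γ ⊢ C
  =I   : ∀ t → Γ ⊢ t ≐ t
  =E   : ∀ {A x} (t₁ t₂ : Term) → Atomic A →
         Substitutable t₁ x A → Substitutable t₂ x A →
         Γ ⊢ t₁ ≐ t₂ → Γ ⊢ A [ x ≔ t₁ ] → Γ ⊢ A [ x ≔ t₂ ]
  lambert : ∀ (F : Formula) (x y : Var) → x ≢ y →
         Γ ⊢ ∀' y ((ι x F ≐ var y) ⇔ ∀' x (F ⇔ (var x ≐ var y)))

{-# OPTIONS --safe #-}
module Submission where

-- Since ιxF exists, Lambert's Law may be instantiated at y := ιxF itself.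
-- Its left side ιxF = ιxF is an instance of =I, so ∀x(F ↔ x = ιxF) holds,
-- and together with G(ιxF) this makes ιxF a witness for ∃I.

open import Defs
open import Data.Bool using (true; false; _∧_; _∨_)
open import Data.Bool.Properties using (∨-conicalˡ; ∨-conicalʳ)
open import Data.Empty using (⊥-elim)
open import Data.List using (List; []; _∷_)
open import Data.List.Relation.Unary.Any using (here; there)
open import Data.Nat using (_≡ᵇ_)
open import Data.Nat.Properties using (≡ᵇ⇒≡; ≡⇒≡ᵇ)
open import Relation.Binary.PropositionalEquality
  using (_≡_; _≢_; refl; sym; trans; cong; cong₂; subst)

≡ᵇ-refl : ∀ n → (n ≡ᵇ n) ≡ true
≡ᵇ-refl n with n ≡ᵇ n | ≡⇒≡ᵇ n n refl
... | true | _ = refl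

≢⇒≡ᵇ-false : ∀ {m n} → m ≢ n → (m ≡ᵇ n) ≡ false
≢⇒≡ᵇ-false {m} {n} m≢n with m ≡ᵇ n | ≡ᵇ⇒≡ m n
... | true  | m≡n = ⊥-elim (m≢n (m≡n _))
... | false | _   = refl

substT-var : ∀ v t → substT (var v) v t ≡ t
substT-var v t rewrite ≡ᵇ-refl v = refl

module _ {v : Var} where

  mutual
    freeT-notOcc : ∀ s → occT v s ≡ false → freeT v s ≡ false
    freeT-notOcc (var w) o = o
    freeT-notOcc (par a) o = refl
    freeT-notOcc (ι w F) o with w ≡ᵇ v
    ... | true  = refl
    ... | false = freeF-notOcc F o

    freeTs-notOcc : ∀ ss → occTs v ss ≡ false → freeTs v ss ≡ false
    freeTs-notOcc []       o = refl
    freeTs-notOcc (s ∷ ss) o =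
      cong₂ _∨_ (freeT-notOcc s (∨-conicalˡ _ _ o)) (freeTs-notOcc ss (∨-conicalʳ _ _ o))

    freeF-notOcc : ∀ A → occF v A ≡ false → freeF v A ≡ false
    freeF-notOcc (rel P ts) o = freeTs-notOcc ts o
    freeF-notOcc (E! s)     o = freeT-notOcc s o
    freeF-notOcc (s ≐ r)    o =
      cong₂ _∨_ (freeT-notOcc s (∨-conicalˡ _ _ o)) (freeT-notOcc r (∨-conicalʳ _ _ o))
    freeF-notOcc ⊥'         o = refl
    freeF-notOcc (A ∧' B)   o =
      cong₂ _∨_ (freeF-notOcc A (∨-conicalˡ _ _ o)) (freeF-notOcc B (∨-conicalʳ _ _ o))
    freeF-notOcc (A ⇒ B)    o =
      cong₂ _∨_ (freeF-notOcc A (∨-conicalˡ _ _ o)) (freeF-notOcc B (∨-conicalʳ _ _ o))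
    freeF-notOcc (A ∨' B)   o =
      cong₂ _∨_ (freeF-notOcc A (∨-conicalˡ _ _ o)) (freeF-notOcc B (∨-conicalʳ _ _ o))
    freeF-notOcc (A ⇔ B)    o =
      cong₂ _∨_ (freeF-notOcc A (∨-conicalˡ _ _ o)) (freeF-notOcc B (∨-conicalʳ _ _ o))
    freeF-notOcc (∀' w A)   o with w ≡ᵇ v
    ... | true  = refl
    ... | false = freeF-notOcc A o
    freeF-notOcc (∃' w A)   o with w ≡ᵇ v
    ... | true  = refl
    ... | false = freeF-notOcc A o

module _ {v : Var} (t : Term) where

  mutual
    substT-notOcc : ∀ s → occT v s ≡ false → substT s v t ≡ s
    substT-notOcc (var w) o rewrite o = refl
    substT-notOcc (par a) o = refl
    substT-notOcc (ι w F) o with w ≡ᵇ v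
    ... | true  = refl
    ... | false = cong (ι w) (substF-notOcc F o)

    substTs-notOcc : ∀ ss → occTs v ss ≡ false → substTs ss v t ≡ ss
    substTs-notOcc []       o = refl
    substTs-notOcc (s ∷ ss) o =
      cong₂ _∷_ (substT-notOcc s (∨-conicalˡ _ _ o)) (substTs-notOcc ss (∨-conicalʳ _ _ o))

    substF-notOcc : ∀ A → occF v A ≡ false → substF A v t ≡ A
    substF-notOcc (rel P ts) o = cong (rel P) (substTs-notOcc ts o)
    substF-notOcc (E! s)     o = cong E! (substT-notOcc s o)
    substF-notOcc (s ≐ r)    o =
      cong₂ _≐_ (substT-notOcc s (∨-conicalˡ _ _ o)) (substT-notOcc r (∨-conicalʳ _ _ o))
    substF-notOcc ⊥'         o = refl
    substF-notOcc (A ∧' B)   o =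
      cong₂ _∧'_ (substF-notOcc A (∨-conicalˡ _ _ o)) (substF-notOcc B (∨-conicalʳ _ _ o))
    substF-notOcc (A ⇒ B)    o =
      cong₂ _⇒_ (substF-notOcc A (∨-conicalˡ _ _ o)) (substF-notOcc B (∨-conicalʳ _ _ o))
    substF-notOcc (A ∨' B)   o =
      cong₂ _∨'_ (substF-notOcc A (∨-conicalˡ _ _ o)) (substF-notOcc B (∨-conicalʳ _ _ o))
    substF-notOcc (A ⇔ B)    o =
      cong₂ _⇔_ (substF-notOcc A (∨-conicalˡ _ _ o)) (substF-notOcc B (∨-conicalʳ _ _ o))
    substF-notOcc (∀' w A)   o with w ≡ᵇ v
    ... | true  = refl
    ... | false = cong (∀' w) (substF-notOcc A o)
    substF-notOcc (∃' w A)   o with w ≡ᵇ v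
    ... | true  = refl
    ... | false = cong (∃' w) (substF-notOcc A o)

  mutual
    subOKT-notOcc : ∀ s → occT v s ≡ false → subOKT t v s ≡ true
    subOKT-notOcc (var w) o = refl
    subOKT-notOcc (par a) o = refl
    subOKT-notOcc (ι w F) o rewrite freeT-notOcc (ι w F) o = refl

    subOKTs-notOcc : ∀ ss → occTs v ss ≡ false → subOKTs t v ss ≡ true
    subOKTs-notOcc []       o = refl
    subOKTs-notOcc (s ∷ ss) o =
      cong₂ _∧_ (subOKT-notOcc s (∨-conicalˡ _ _ o)) (subOKTs-notOcc ss (∨-conicalʳ _ _ o))

    subOKF-notOcc : ∀ A → occF v A ≡ false → Substitutable t v A
    subOKF-notOcc (rel P ts) o = subOKTs-notOcc ts o
    subOKF-notOcc (E! s)     o = subOKT-notOcc s o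
    subOKF-notOcc (s ≐ r)    o =
      cong₂ _∧_ (subOKT-notOcc s (∨-conicalˡ _ _ o)) (subOKT-notOcc r (∨-conicalʳ _ _ o))
    subOKF-notOcc ⊥'         o = refl
    subOKF-notOcc (A ∧' B)   o =
      cong₂ _∧_ (subOKF-notOcc A (∨-conicalˡ _ _ o)) (subOKF-notOcc B (∨-conicalʳ _ _ o))
    subOKF-notOcc (A ⇒ B)    o =
      cong₂ _∧_ (subOKF-notOcc A (∨-conicalˡ _ _ o)) (subOKF-notOcc B (∨-conicalʳ _ _ o))
    subOKF-notOcc (A ∨' B)   o =
      cong₂ _∧_ (subOKF-notOcc A (∨-conicalˡ _ _ o)) (subOKF-notOcc B (∨-conicalʳ _ _ o))
    subOKF-notOcc (A ⇔ B)    o =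
      cong₂ _∧_ (subOKF-notOcc A (∨-conicalˡ _ _ o)) (subOKF-notOcc B (∨-conicalʳ _ _ o))
    subOKF-notOcc (∀' w A)   o rewrite freeF-notOcc (∀' w A) o = refl
    subOKF-notOcc (∃' w A)   o rewrite freeF-notOcc (∃' w A) o = refl

module _ {v : Var} (z : Var) where

  mutual
    freeT-rename : ∀ s → occT v s ≡ false → freeT v (substT s z (var v)) ≡ freeT z s
    freeT-rename (var w) o with w ≡ᵇ z
    ... | true  = ≡ᵇ-refl v
    ... | false = o
    freeT-rename (par a) o = refl
    freeT-rename (ι w F) o with w ≡ᵇ z
    ... | true  rewrite ∨-conicalˡ (w ≡ᵇ v) _ o = freeF-notOcc F (∨-conicalʳ _ _ o)
    ... | false rewrite ∨-conicalˡ (w ≡ᵇ v) _ o = freeF-rename F (∨-conicalʳ _ _ o)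

    freeTs-rename : ∀ ss → occTs v ss ≡ false →
                    freeTs v (substTs ss z (var v)) ≡ freeTs z ss
    freeTs-rename []       o = refl
    freeTs-rename (s ∷ ss) o =
      cong₂ _∨_ (freeT-rename s (∨-conicalˡ _ _ o)) (freeTs-rename ss (∨-conicalʳ _ _ o))

    freeF-rename : ∀ A → occF v A ≡ false → freeF v (substF A z (var v)) ≡ freeF z A
    freeF-rename (rel P ts) o = freeTs-rename ts o
    freeF-rename (E! s)     o = freeT-rename s o
    freeF-rename (s ≐ r)    o =
      cong₂ _∨_ (freeT-rename s (∨-conicalˡ _ _ o)) (freeT-rename r (∨-conicalʳ _ _ o))
    freeF-rename ⊥'         o = refl
    freeF-rename (A ∧' B)   o =
      cong₂ _∨_ (freeF-rename A (∨-conicalˡ _ _ o)) (freeF-rename B (∨-conicalʳ _ _ o))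
    freeF-rename (A ⇒ B)    o =
      cong₂ _∨_ (freeF-rename A (∨-conicalˡ _ _ o)) (freeF-rename B (∨-conicalʳ _ _ o))
    freeF-rename (A ∨' B)   o =
      cong₂ _∨_ (freeF-rename A (∨-conicalˡ _ _ o)) (freeF-rename B (∨-conicalʳ _ _ o))
    freeF-rename (A ⇔ B)    o =
      cong₂ _∨_ (freeF-rename A (∨-conicalˡ _ _ o)) (freeF-rename B (∨-conicalʳ _ _ o))
    freeF-rename (∀' w A)   o with w ≡ᵇ z
    ... | true  rewrite ∨-conicalˡ (w ≡ᵇ v) _ o = freeF-notOcc A (∨-conicalʳ _ _ o)
    ... | false rewrite ∨-conicalˡ (w ≡ᵇ v) _ o = freeF-rename A (∨-conicalʳ _ _ o)
    freeF-rename (∃' w A)   o with w ≡ᵇ z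
    ... | true  rewrite ∨-conicalˡ (w ≡ᵇ v) _ o = freeF-notOcc A (∨-conicalʳ _ _ o)
    ... | false rewrite ∨-conicalˡ (w ≡ᵇ v) _ o = freeF-rename A (∨-conicalʳ _ _ o)

  module _ (t : Term) where

    mutual
      substT-rename : ∀ s → occT v s ≡ false → substT (substT s z (var v)) v t ≡ substT s z t
      substT-rename (var w) o with w ≡ᵇ z
      ... | true  = substT-var v t
      ... | false rewrite o = refl
      substT-rename (par a) o = refl
      substT-rename (ι w F) o with w ≡ᵇ z
      ... | true  rewrite ∨-conicalˡ (w ≡ᵇ v) _ o =
        cong (ι w) (substF-notOcc t F (∨-conicalʳ _ _ o))
      ... | false rewrite ∨-conicalˡ (w ≡ᵇ v) _ o =
        cong (ι w) (substF-rename F (∨-conicalʳ _ _ o))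

      substTs-rename : ∀ ss → occTs v ss ≡ false →
                       substTs (substTs ss z (var v)) v t ≡ substTs ss z t
      substTs-rename []       o = refl
      substTs-rename (s ∷ ss) o =
        cong₂ _∷_ (substT-rename s (∨-conicalˡ _ _ o)) (substTs-rename ss (∨-conicalʳ _ _ o))

      substF-rename : ∀ A → occF v A ≡ false → A [ z ≔ var v ] [ v ≔ t ] ≡ A [ z ≔ t ]
      substF-rename (rel P ts) o = cong (rel P) (substTs-rename ts o)
      substF-rename (E! s)     o = cong E! (substT-rename s o)
      substF-rename (s ≐ r)    o =
        cong₂ _≐_ (substT-rename s (∨-conicalˡ _ _ o)) (substT-rename r (∨-conicalʳ _ _ o))
      substF-rename ⊥'         o = refl
      substF-rename (A ∧' B)   o =
        cong₂ _∧'_ (substF-rename A (∨-conicalˡ _ _ o)) (substF-rename B (∨-conicalʳ _ _ o))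
      substF-rename (A ⇒ B)    o =
        cong₂ _⇒_ (substF-rename A (∨-conicalˡ _ _ o)) (substF-rename B (∨-conicalʳ _ _ o))
      substF-rename (A ∨' B)   o =
        cong₂ _∨'_ (substF-rename A (∨-conicalˡ _ _ o)) (substF-rename B (∨-conicalʳ _ _ o))
      substF-rename (A ⇔ B)    o =
        cong₂ _⇔_ (substF-rename A (∨-conicalˡ _ _ o)) (substF-rename B (∨-conicalʳ _ _ o))
      substF-rename (∀' w A)   o with w ≡ᵇ z
      ... | true  rewrite ∨-conicalˡ (w ≡ᵇ v) _ o =
        cong (∀' w) (substF-notOcc t A (∨-conicalʳ _ _ o))
      ... | false rewrite ∨-conicalˡ (w ≡ᵇ v) _ o =
        cong (∀' w) (substF-rename A (∨-conicalʳ _ _ o))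
      substF-rename (∃' w A)   o with w ≡ᵇ z
      ... | true  rewrite ∨-conicalˡ (w ≡ᵇ v) _ o =
        cong (∃' w) (substF-notOcc t A (∨-conicalʳ _ _ o))
      ... | false rewrite ∨-conicalˡ (w ≡ᵇ v) _ o =
        cong (∃' w) (substF-rename A (∨-conicalʳ _ _ o))

    mutual
      subOKT-rename : ∀ s → occT v s ≡ false → subOKT t v (substT s z (var v)) ≡ subOKT t z s
      subOKT-rename (var w) o with w ≡ᵇ z
      ... | true  = refl
      ... | false = refl
      subOKT-rename (par a) o = refl
      subOKT-rename (ι w F) o with w ≡ᵇ z
      ... | true  rewrite ∨-conicalˡ (w ≡ᵇ v) _ o
                        | freeF-notOcc F (∨-conicalʳ _ _ o) = refl
      ... | false rewrite ∨-conicalˡ (w ≡ᵇ v) _ o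
                        | freeF-rename F (∨-conicalʳ _ _ o)
                        | subOKF-rename F (∨-conicalʳ _ _ o) = refl

      subOKTs-rename : ∀ ss → occTs v ss ≡ false →
                       subOKTs t v (substTs ss z (var v)) ≡ subOKTs t z ss
      subOKTs-rename []       o = refl
      subOKTs-rename (s ∷ ss) o =
        cong₂ _∧_ (subOKT-rename s (∨-conicalˡ _ _ o)) (subOKTs-rename ss (∨-conicalʳ _ _ o))

      subOKF-rename : ∀ A → occF v A ≡ false → subOKF t v (A [ z ≔ var v ]) ≡ subOKF t z A
      subOKF-rename (rel P ts) o = subOKTs-rename ts o
      subOKF-rename (E! s)     o = subOKT-rename s o
      subOKF-rename (s ≐ r)    o =
        cong₂ _∧_ (subOKT-rename s (∨-conicalˡ _ _ o)) (subOKT-rename r (∨-conicalʳ _ _ o))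
      subOKF-rename ⊥'         o = refl
      subOKF-rename (A ∧' B)   o =
        cong₂ _∧_ (subOKF-rename A (∨-conicalˡ _ _ o)) (subOKF-rename B (∨-conicalʳ _ _ o))
      subOKF-rename (A ⇒ B)    o =
        cong₂ _∧_ (subOKF-rename A (∨-conicalˡ _ _ o)) (subOKF-rename B (∨-conicalʳ _ _ o))
      subOKF-rename (A ∨' B)   o =
        cong₂ _∧_ (subOKF-rename A (∨-conicalˡ _ _ o)) (subOKF-rename B (∨-conicalʳ _ _ o))
      subOKF-rename (A ⇔ B)    o =
        cong₂ _∧_ (subOKF-rename A (∨-conicalˡ _ _ o)) (subOKF-rename B (∨-conicalʳ _ _ o))
      subOKF-rename (∀' w A)   o with w ≡ᵇ z
      ... | true  rewrite ∨-conicalˡ (w ≡ᵇ v) _ o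
                        | freeF-notOcc A (∨-conicalʳ _ _ o) = refl
      ... | false rewrite ∨-conicalˡ (w ≡ᵇ v) _ o
                        | freeF-rename A (∨-conicalʳ _ _ o)
                        | subOKF-rename A (∨-conicalʳ _ _ o) = refl
      subOKF-rename (∃' w A)   o with w ≡ᵇ z
      ... | true  rewrite ∨-conicalˡ (w ≡ᵇ v) _ o
                        | freeF-notOcc A (∨-conicalʳ _ _ o) = refl
      ... | false rewrite ∨-conicalˡ (w ≡ᵇ v) _ o
                        | freeF-rename A (∨-conicalʳ _ _ o)
                        | subOKF-rename A (∨-conicalʳ _ _ o) = refl

freeT-ι-bound : ∀ x F → freeT x (ι x F) ≡ false
freeT-ι-bound x F rewrite ≡ᵇ-refl x = refl

Describes : Var → Formula → Term → Formula
Describes x F s = ∀' x (F ⇔ (var x ≐ s))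

module _ (F : Formula) {x y : Var} (x≢y : x ≢ y) (y∉F : occF y F ≡ false) where

  y∉ιxF : occT y (ι x F) ≡ false
  y∉ιxF = cong₂ _∨_ (≢⇒≡ᵇ-false x≢y) y∉F

  substF-Describes : ∀ t → Describes x F (var y) [ y ≔ t ] ≡ Describes x F t
  substF-Describes t
    rewrite ≢⇒≡ᵇ-false x≢y | substF-notOcc t F y∉F | ≡ᵇ-refl y = refl

  subOKF-Describes : ∀ t → freeT x t ≡ false → Substitutable t y (Describes x F (var y))
  subOKF-Describes t x∉t
    rewrite ≢⇒≡ᵇ-false x≢y | freeF-notOcc F y∉F | ≡ᵇ-refl y | x∉t
          | subOKF-notOcc t F y∉F = refl

  lambert-at : ∀ {Γ t} → freeT x t ≡ false → Γ ⊢ E! t →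
               Γ ⊢ (ι x F ≐ t) ⇔ Describes x F t
  lambert-at {Γ} {t} x∉t E!t =
    subst (Γ ⊢_) instance≡ (∀E t substitutable (lambert F x y x≢y) E!t)
    where
    substitutable : Substitutable t y ((ι x F ≐ var y) ⇔ Describes x F (var y))
    substitutable = cong₂ _∧_ (cong₂ _∧_ (subOKT-notOcc t (ι x F) y∉ιxF) refl)
                              (subOKF-Describes t x∉t)

    instance≡ : ((ι x F ≐ var y) ⇔ Describes x F (var y)) [ y ≔ t ] ≡
                ((ι x F ≐ t) ⇔ Describes x F t)
    instance≡ = cong₂ _⇔_ (cong₂ _≐_ (substT-notOcc t (ι x F) y∉ιxF) (substT-var y t))
                          (substF-Describes t)

  Describes-ι : ∀ {Γ} → Γ ⊢ E! (ι x F) → Γ ⊢ Describes x F (ι x F)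
  Describes-ι E!ιxF = ⇔E₁ (lambert-at (freeT-ι-bound x F) E!ιxF) (=I (ι x F))

mainTheorem6 : (F : Formula) (x y : Var) (G : Formula) (z : Var) →
    x ≢ y → occF y F ≡ false → occF y G ≡ false →
    Substitutable (ι x F) z G →
    (E! (ι x F) ∷ G [ z ≔ ι x F ] ∷ []) ⊢
      ∃' y (∀' x (F ⇔ (var x ≐ var y)) ∧' G [ z ≔ var y ])
mainTheorem6 F x y G z x≢y y∉F y∉G ιxF-substitutable =
  ∃I (ι x F) substitutable
     (subst (Γ ⊢_) (sym instance≡) (∧I (Describes-ι F x≢y y∉F E!ιxF) G[ιxF]))
     E!ιxF
  where
  Γ : List Formula
  Γ = E! (ι x F) ∷ G [ z ≔ ι x F ] ∷ []

  E!ιxF : Γ ⊢ E! (ι x F)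
  E!ιxF = hyp (here refl)

  G[ιxF] : Γ ⊢ G [ z ≔ ι x F ]
  G[ιxF] = hyp (there (here refl))

  substitutable : Substitutable (ι x F) y (Describes x F (var y) ∧' G [ z ≔ var y ])
  substitutable = cong₂ _∧_ (subOKF-Describes F x≢y y∉F (ι x F) (freeT-ι-bound x F))
                            (trans (subOKF-rename z (ι x F) G y∉G) ιxF-substitutable)

  instance≡ : (Describes x F (var y) ∧' G [ z ≔ var y ]) [ y ≔ ι x F ] ≡
              (Describes x F (ι x F) ∧' G [ z ≔ ι x F ])
  instance≡ = cong₂ _∧'_ (substF-Describes F x≢y y∉F (ι x F)) (substF-rename z (ι x F) G y∉G)
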